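{- Let $\mathsf{ML}$ be any of the fourteen minimal modal logics $\mathsf{MM},\mathsf{MMP},\mathsf{MMN},\mathsf{MMNP},\mathsf{MMC},\mathsf{MK},\mathsf{MMD},\mathsf{MMT},\mathsf{MMND},\mathsf{MMNT},\mathsf{MMCD},\mathsf{MMCT},\mathsf{MKD},\mathsf{MKT}$. For every formula $A$ of $\mathcal L$, if $A$ is valid in every minimal neighbourhood model for $\mathsf{ML}$, then $A$ is derivable in $\mathsf{ML}$.
   Context: $\mathcal L$ is the language $A ::= p \mid \bot \mid A\wedge A \mid A\vee A \mid A\to A \mid \Box A \mid \Diamond A$ over a countable set $\mathrm{Atm}$; $\top:=\bot\to\bot$. $\mathsf{MPL}$ is axiomatised by $A\wedge B\to A$, $A\wedge B\to B$, $A\to A\vee B$, $B\to A\vee B$, $(A\to B)\to((A\to C)\to(A\to B\wedge C))$, $(A\to C)\to((B\to C)\to(A\vee B\to C))$, $(A\to(B\to C))\to((A\to B)\to(A\to C))$, $A\to(B\to A)$, and modus ponens. Modal principles: Mon$\Box$: rule $A\to B/\Box A\to\Box B$; Mon$\Diamond$: rule $A\to B/\Diamond A\to\Diamond B$; N$\Box$: $\Box\top$; C$\Box$: $\Box A\wedge\Box B\to\Box(A\wedge B)$; K$\Diamond$: $\Box(A\to B)\to(\Diamond A\to\Diamond B)$; P$\Diamond$: $\Diamond\top$; D: $\Box A\to\Diamond A$; T$\Box$: $\Box A\to A$; T$\Diamond$: $A\to\Diamond A$. Logics: $\mathsf{MM}=\mathsf{MPL}$+Mon$\Box$+Mon$\Diamond$;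 $\mathsf{MMP}=\mathsf{MM}$+P$\Diamond$; $\mathsf{MMN}=\mathsf{MM}$+N$\Box$; $\mathsf{MMNP}=\mathsf{MMN}$+P$\Diamond$; $\mathsf{MMC}=\mathsf{MM}$+C$\Box$+K$\Diamond$; $\mathsf{MK}=\mathsf{MMC}$+N$\Box$; $\mathsf{MMD}=\mathsf{MM}$+D+P$\Diamond$; $\mathsf{MMT}=\mathsf{MM}$+T$\Box$+T$\Diamond$; $\mathsf{MMND}=\mathsf{MMN}$+D; $\mathsf{MMNT}=\mathsf{MMN}$+T$\Box$+T$\Diamond$; $\mathsf{MMCD}=\mathsf{MMC}$+D+P$\Diamond$; $\mathsf{MMCT}=\mathsf{MMC}$+T$\Box$+T$\Diamond$; $\mathsf{MKD}=\mathsf{MK}$+D; $\mathsf{MKT}=\mathsf{MK}$+T$\Box$+T$\Diamond$. A minimal neighbourhood model is $\langle W,\le,F,N,V\rangle$ with $W\ne\emptyset$, $\le$ reflexive transitive, $F$ and each $V(p)$ upward closed under $\le$, $N:W\to\mathcal P(\mathcal P(W))$. Forcing: $w\Vdash p$ iff $w\in V(p)$; $w\Vdash\bot$ iff $w\in F$; $\wedge,\vee$ pointwise; $w\Vdash B\to C$ iff for all $v\ge w$, $v\Vdash B$ implies $v\Vdash C$; $w\Vdash\Box B$ iff for all $v\ge w$ some $\alpha\in N(v)$ has all its elements forcing $B$; $w\Vdash\Diamond B$ iff for all $v\ge w$, every $\alpha\in N(v)$ contains an element forcing $B$. Conditions: (C) $\alpha,\beta\in N(w)\Rightarrow\alpha\cap\beta\in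 N(w)$; (N) $N(w)\ne\emptyset$; (D) $\alpha,\beta\in N(w)\Rightarrow\alpha\cap\beta\ne\emptyset$; (P) $\emptyset\notin N(w)$; (T) $\alpha\in N(w)\Rightarrow w\in\alpha$. Models for $\mathsf{ML}$ satisfy: $\mathsf{MM}$: none; $\mathsf{MMP}$: P; $\mathsf{MMN}$: N; $\mathsf{MMNP}$: N,P; $\mathsf{MMC}$: C; $\mathsf{MK}$: C,N; $\mathsf{MMD}$: D; $\mathsf{MMT}$: T; $\mathsf{MMND}$: N,D; $\mathsf{MMNT}$: N,T; $\mathsf{MMCD}$: C,D; $\mathsf{MMCT}$: C,T; $\mathsf{MKD}$: C,N,D; $\mathsf{MKT}$: C,N,T. -}

module Defs where

open import Level using (Level; 0ℓ) renaming (suc to lsuc)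
open import Data.Nat using (ℕ)
open import Data.Bool using (Bool; true; false; T)
open import Data.Product using (Σ; _×_; _,_)
open import Data.Empty using (⊥)
open import Data.Sum using (_⊎_)
open import Data.Unit using (⊤)
open import Relation.Nullary using (¬_)

Atm : Set
Atm = ℕ

infixr 6 _∧_
infixr 5 _∨_
infixr 4 _⇒_

data Fm : Set where
  atom : Atm → Fm
  ⊥'   : Fm
  _∧_  : Fm → Fm → Fm
  _∨_  : Fm → Fm → Fm
  _⇒_  : Fm → Fm → Fm
  □    : Fm → Fm
  ◇    : Fm → Fm

⊤' : Fm
⊤' = ⊥' ⇒ ⊥'

data Logic : Set where
  MM MMP MMN MMNP MMC MK MMD MMT MMND MMNT MMCD MMCT MKD MKT : Logic

hasN□ : Logic → Bool
hasN□ MMN  = true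
hasN□ MMNP = true
hasN□ MK   = true
hasN□ MMND = true
hasN□ MMNT = true
hasN□ MKD  = true
hasN□ MKT  = true
hasN□ _    = false

hasP◇ : Logic → Bool
hasP◇ MMP  = true
hasP◇ MMNP = true
hasP◇ MMD  = true
hasP◇ MMCD = true
hasP◇ _    = false

hasCK : Logic → Bool
hasCK MMC  = true
hasCK MK   = true
hasCK MMCD = true
hasCK MMCT = true
hasCK MKD  = true
hasCK MKT  = true
hasCK _    = false

hasD : Logic → Bool
hasD MMD  = true
hasD MMND = true
hasD MMCD = true
hasD MKD  = true
hasD _    = false

hasT : Logic → Bool
hasT MMT  = true
hasT MMNT = true
hasT MMCT = true
hasT MKT  = true
hasT _    = false

infix 2 _⊢_

data _⊢_ (L : Logic) : Fm → Set where
  ax∧₁ : ∀ {A B} → L ⊢ A ∧ B ⇒ A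
  ax∧₂ : ∀ {A B} → L ⊢ A ∧ B ⇒ B
  ax∨₁ : ∀ {A B} → L ⊢ A ⇒ A ∨ B
  ax∨₂ : ∀ {A B} → L ⊢ B ⇒ A ∨ B
  ax∧I : ∀ {A B C} → L ⊢ (A ⇒ B) ⇒ ((A ⇒ C) ⇒ (A ⇒ B ∧ C))
  ax∨E : ∀ {A B C} → L ⊢ (A ⇒ C) ⇒ ((B ⇒ C) ⇒ (A ∨ B ⇒ C))
  axS  : ∀ {A B C} → L ⊢ (A ⇒ (B ⇒ C)) ⇒ ((A ⇒ B) ⇒ (A ⇒ C))
  axK  : ∀ {A B} → L ⊢ A ⇒ (B ⇒ A)
  mp   : ∀ {A B} → L ⊢ A ⇒ B → L ⊢ A → L ⊢ B
  mon□ : ∀ {A B} → L ⊢ A ⇒ B → L ⊢ □ A ⇒ □ B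
  mon◇ : ∀ {A B} → L ⊢ A ⇒ B → L ⊢ ◇ A ⇒ ◇ B
  axN□ : T (hasN□ L) → L ⊢ □ ⊤'
  axP◇ : T (hasP◇ L) → L ⊢ ◇ ⊤'
  axC□ : ∀ {A B} → T (hasCK L) → L ⊢ □ A ∧ □ B ⇒ □ (A ∧ B)
  axK◇ : ∀ {A B} → T (hasCK L) → L ⊢ □ (A ⇒ B) ⇒ (◇ A ⇒ ◇ B)
  axD  : ∀ {A} → T (hasD L) → L ⊢ □ A ⇒ ◇ A
  axT□ : ∀ {A} → T (hasT L) → L ⊢ □ A ⇒ A
  axT◇ : ∀ {A} → T (hasT L) → L ⊢ A ⇒ ◇ A

record Model : Set₁ where
  field
    W     : Set
    inhab : W
    _≤_   : W → W → Set
    ≤-refl  : ∀ {w} → w ≤ w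
    ≤-trans : ∀ {u v w} → u ≤ v → v ≤ w → u ≤ w
    F     : W → Set
    F-up  : ∀ {w v} → w ≤ v → F w → F v
    V     : Atm → W → Set
    V-up  : ∀ p {w v} → w ≤ v → V p w → V p v
    N     : W → (W → Set) → Set

open Model public

_∩_ : {W : Set} → (W → Set) → (W → Set) → (W → Set)
(α ∩ β) x = α x × β x

CondC CondN CondD CondP CondT : Model → Set₁
CondC M = ∀ w α β → N M w α → N M w β → N M w (α ∩ β)
CondN M = ∀ w → Σ (W M → Set) (λ α → N M w α)
CondD M = ∀ w α β → N M w α → N M w β → Σ (W M) (λ x → (α ∩ β) x)
CondP M = ∀ w α → N M w α → Σ (W M) (λ x → α x)
CondT M = ∀ w α → N M w α → α w

Lift₁ : Set → Set₁
Lift₁ A = Level.Lift (lsuc 0ℓ) A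

ModelFor : Logic → Model → Set₁
ModelFor MM   M = Lift₁ ⊤
ModelFor MMP  M = CondP M
ModelFor MMN  M = CondN M
ModelFor MMNP M = CondN M × CondP M
ModelFor MMC  M = CondC M
ModelFor MK   M = CondC M × CondN M
ModelFor MMD  M = CondD M
ModelFor MMT  M = CondT M
ModelFor MMND M = CondN M × CondD M
ModelFor MMNT M = CondN M × CondT M
ModelFor MMCD M = CondC M × CondD M
ModelFor MMCT M = CondC M × CondT M
ModelFor MKD  M = CondC M × CondN M × CondD M
ModelFor MKT  M = CondC M × CondN M × CondT M

forces : (M : Model) → W M → Fm → Set₁
forces M w (atom p) = Lift₁ (V M p w)
forces M w ⊥'       = Lift₁ (F M w)
forces M w (A ∧ B)  = forces M w A × forces M w B
forces M w (A ∨ B)  = forces M w A ⊎ forces M w B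
forces M w (A ⇒ B)  = ∀ v → _≤_ M w v → forces M v A → forces M v B
forces M w (□ A)    = ∀ v → _≤_ M w v →
                        Σ (W M → Set) (λ α → N M v α × (∀ u → α u → forces M u A))
forces M w (◇ A)    = ∀ v → _≤_ M w v →
                        ∀ α → N M v α → Σ (W M) (λ u → α u × forces M u A)

ValidIn : Model → Fm → Set₁
ValidIn M A = ∀ w → forces M w A

Valid : Logic → Fm → Set₁
Valid L A = ∀ (M : Model) → ModelFor L M → ValidIn M A

module Submission where

-- The canonical model is finite and built constructively.  Fix A and put R = (L ⊢ A).
-- A formula "holds" at a set of hypotheses if it is derivable from them or R holds
-- (Friedman's translation); in the continuation monad with answer type R excluded middle
-- is available, so we may assume a table deciding every question "X ⊢ C" for X ⊆ S and
-- C ∈ S, where S is the finite set of subformulas of A ∧ □⊤.  Worlds are prime subsets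
-- of S (Lindenbaum inside S), ordered by what holds in them.  The neighbourhoods of w are
-- the sets {u | D₁ … Dₙ hold at u} for □D₁ … □Dₙ holding at w, and, at a copy of w
-- tagged by a failing ◇E, the set of worlds refuting E.  The inconsistent world lies in
-- every neighbourhood of the first kind, which gives ◇ and the conditions P and D their
-- witnesses.  The truth lemma then holds on S, and the Lindenbaum extension of ∅ avoiding A
-- refutes A unless R.

open import Defs
open import Level using (lift; lower)
open import Function using (id)
open import Data.Bool using (Bool; true; false; T) renaming (_∨_ to _or_)
open import Data.Unit using (⊤; tt)
open import Data.Empty using (⊥; ⊥-elim)
open import Data.Product using (Σ; _×_; _,_; proj₁; proj₂)
open import Data.Sum using (_⊎_; inj₁; inj₂; [_,_]) renaming (map to ⊎-map)
open import Data.Maybe using (Maybe; just; nothing; Is-just)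
open import Data.Maybe.Relation.Unary.Any using (just)
open import Data.Nat using (zero; suc)
open import Data.List using (List; []; _∷_; _++_; length)
open import Data.List.Properties using (++-identityʳ)
open import Data.List.Membership.Propositional using (_∈_)
open import Data.List.Membership.Propositional.Properties using (∈-++⁺ˡ; ∈-++⁺ʳ; ∈-++⁻)
open import Data.List.Relation.Binary.Subset.Propositional using (_⊆_)
open import Data.List.Relation.Binary.Subset.Propositional.Properties using (∷⁺ʳ)
open import Data.List.Relation.Unary.Any using (here; there)
open import Data.List.Relation.Unary.All as All using (All; []; _∷_; tabulate)
open import Data.List.Relation.Unary.All.Properties using (++⁺; ++⁻ˡ; ++⁻ʳ)
open import Data.Vec using (Vec; []; _∷_)
open import Relation.Binary.PropositionalEquality using (_≡_; refl)

module Hypotheses (L : Logic) where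

  infix 2 _⊢ₕ_

  data _⊢ₕ_ (Γ : List Fm) : Fm → Set where
    hyp : ∀ {A} → A ∈ Γ → Γ ⊢ₕ A
    thm : ∀ {A} → L ⊢ A → Γ ⊢ₕ A
    app : ∀ {A B} → Γ ⊢ₕ A ⇒ B → Γ ⊢ₕ A → Γ ⊢ₕ B

  ⊢-id : ∀ {A} → L ⊢ A ⇒ A
  ⊢-id {A} = mp (mp axS (axK {B = A ⇒ A})) (axK {B = A})

  deduction : ∀ {Γ A B} → A ∷ Γ ⊢ₕ B → Γ ⊢ₕ A ⇒ B
  deduction (hyp (here refl)) = thm ⊢-id
  deduction (hyp (there p))   = app (thm axK) (hyp p)
  deduction (thm t)           = app (thm axK) (thm t)
  deduction (app d e)         = app (app (thm axS) (deduction d)) (deduction e)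

  cut : ∀ {Γ Δ B} → (∀ {D} → D ∈ Γ → Δ ⊢ₕ D) → Γ ⊢ₕ B → Δ ⊢ₕ B
  cut f (hyp p)   = f p
  cut f (thm t)   = thm t
  cut f (app d e) = app (cut f d) (cut f e)

  weaken : ∀ {Γ Δ B} → Γ ⊆ Δ → Γ ⊢ₕ B → Δ ⊢ₕ B
  weaken Γ⊆Δ = cut (λ p → hyp (Γ⊆Δ p))

  closed : ∀ {B} → [] ⊢ₕ B → L ⊢ B
  closed (hyp ())
  closed (thm t)   = t
  closed (app d e) = mp (closed d) (closed e)

  ∧-intro : ∀ {Γ A B} → Γ ⊢ₕ A → Γ ⊢ₕ B → Γ ⊢ₕ A ∧ B
  ∧-intro a b = app (app (app (thm ax∧I) (app (thm axK) a)) (app (thm axK) b)) (thm (⊢-id {⊥'}))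

  ∧-elim₁ : ∀ {Γ A B} → Γ ⊢ₕ A ∧ B → Γ ⊢ₕ A
  ∧-elim₁ = app (thm ax∧₁)

  ∧-elim₂ : ∀ {Γ A B} → Γ ⊢ₕ A ∧ B → Γ ⊢ₕ B
  ∧-elim₂ = app (thm ax∧₂)

  ∨-intro₁ : ∀ {Γ A B} → Γ ⊢ₕ A → Γ ⊢ₕ A ∨ B
  ∨-intro₁ = app (thm ax∨₁)

  ∨-intro₂ : ∀ {Γ A B} → Γ ⊢ₕ B → Γ ⊢ₕ A ∨ B
  ∨-intro₂ = app (thm ax∨₂)

  ∨-elim : ∀ {Γ A B C} → Γ ⊢ₕ A ∨ B → A ∷ Γ ⊢ₕ C → B ∷ Γ ⊢ₕ C → Γ ⊢ₕ C
  ∨-elim d e f = app (app (app (thm ax∨E) (deduction e)) (deduction f)) d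

  ⇒-trans : ∀ {A B C} → L ⊢ A ⇒ B → L ⊢ B ⇒ C → L ⊢ A ⇒ C
  ⇒-trans f g = closed (deduction (app (thm g) (app (thm f) (hyp (here refl)))))

  ⋀ : Fm → List Fm → Fm
  ⋀ d []       = d
  ⋀ d (e ∷ es) = d ∧ ⋀ e es

  ⋀-proj : ∀ {d es D} → D ∈ d ∷ es → L ⊢ ⋀ d es ⇒ D
  ⋀-proj {es = []}     (here refl) = ⊢-id
  ⋀-proj {es = _ ∷ _}  (here refl) = ax∧₁
  ⋀-proj {es = _ ∷ _}  (there p)   = ⇒-trans ax∧₂ (⋀-proj p)

  ⋀-⇒ : ∀ {d es B} → d ∷ es ⊢ₕ B → L ⊢ ⋀ d es ⇒ B
  ⋀-⇒ d = closed (deduction (cut (λ p → app (thm (⋀-proj p)) (hyp (here refl))) d))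

  ⋀-⇒-⇒ : ∀ {B d es E} → B ∷ d ∷ es ⊢ₕ E → L ⊢ ⋀ d es ⇒ (B ⇒ E)
  ⋀-⇒-⇒ d = closed (deduction (deduction (cut premise d)))
    where
    premise : ∀ {B d es D} → D ∈ B ∷ d ∷ es → B ∷ ⋀ d es ∷ [] ⊢ₕ D
    premise (here refl) = hyp (here refl)
    premise (there p)   = app (thm (⋀-proj p)) (hyp (there (here refl)))

  Conjoinable : List Fm → Set
  Conjoinable []       = ⊤
  Conjoinable (_ ∷ es) = es ≡ [] ⊎ T (hasCK L)

  □-⋀ : ∀ {Γ d es} → All (λ D → Γ ⊢ₕ □ D) (d ∷ es) → Conjoinable (d ∷ es) → Γ ⊢ₕ □ (⋀ d es)
  □-⋀ {es = []}    (b ∷ [])  _         = b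
  □-⋀ {es = _ ∷ _} (b ∷ bs) (inj₂ ck) = app (thm (axC□ ck)) (∧-intro b (□-⋀ bs (inj₂ ck)))

module _ {A : Set} where

  Subset : List A → Set
  Subset xs = Vec Bool (length xs)

  selected : (xs : List A) → Subset xs → List A
  selected []       []          = []
  selected (x ∷ xs) (true ∷ X)  = x ∷ selected xs X
  selected (x ∷ xs) (false ∷ X) = selected xs X

  insert : ∀ {D xs} → D ∈ xs → Subset xs → Subset xs
  insert (here _)  (_ ∷ X) = true ∷ X
  insert (there p) (b ∷ X) = b ∷ insert p X

  ∈-insert : ∀ {D xs} (p : D ∈ xs) X → D ∈ selected xs (insert p X)
  ∈-insert (here refl) (_ ∷ X)     = here refl
  ∈-insert (there p)   (true ∷ X)  = there (∈-insert p X)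
  ∈-insert (there p)   (false ∷ X) = ∈-insert p X

  insert-⊆ : ∀ {D xs} (p : D ∈ xs) X → selected xs (insert p X) ⊆ D ∷ selected xs X
  insert-⊆ (here refl) (true ∷ X)  q         = there q
  insert-⊆ (here refl) (false ∷ X) q         = q
  insert-⊆ (there p)   (true ∷ X)  (here e)  = there (here e)
  insert-⊆ (there p)   (true ∷ X)  (there q) with insert-⊆ p X q
  ... | here e  = here e
  ... | there r = there (there r)
  insert-⊆ (there p)   (false ∷ X) q         = insert-⊆ p X q

  ⊆-insert : ∀ {D xs} (p : D ∈ xs) X → selected xs X ⊆ selected xs (insert p X)
  ⊆-insert (here _)  (true ∷ X)  q         = q
  ⊆-insert (here _)  (false ∷ X) q         = there q
  ⊆-insert (there p) (true ∷ X)  (here e)  = here e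
  ⊆-insert (there p) (true ∷ X)  (there q) = there (⊆-insert p X q)
  ⊆-insert (there p) (false ∷ X) q         = ⊆-insert p X q

  full : (xs : List A) → Subset xs
  full []       = []
  full (_ ∷ xs) = true ∷ full xs

  ∈-full : ∀ {D xs} → D ∈ xs → D ∈ selected xs (full xs)
  ∈-full (here e)  = here e
  ∈-full (there p) = there (∈-full p)

  empty : (xs : List A) → Subset xs
  empty []       = []
  empty (_ ∷ xs) = false ∷ empty xs

  ∉-empty : ∀ {D} xs → D ∈ selected xs (empty xs) → ⊥
  ∉-empty (_ ∷ xs) q = ∉-empty xs q

  fromAll : ∀ {xs Ds} → All (_∈ xs) Ds → Subset xs
  fromAll {xs} []       = empty xs
  fromAll      (p ∷ ps) = insert p (fromAll ps)

  ∈-fromAll : ∀ {xs Ds} (ps : All (_∈ xs) Ds) → Ds ⊆ selected xs (fromAll ps)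
  ∈-fromAll (p ∷ ps) (here refl) = ∈-insert p _
  ∈-fromAll (p ∷ ps) (there q)   = ⊆-insert p _ (∈-fromAll ps q)

  fromAll-⊆ : ∀ {xs Ds} (ps : All (_∈ xs) Ds) → selected xs (fromAll ps) ⊆ Ds
  fromAll-⊆ {xs} []       q = ⊥-elim (∉-empty xs q)
  fromAll-⊆      (p ∷ ps) q with insert-⊆ p _ q
  ... | here e  = here e
  ... | there r = there (fromAll-⊆ ps r)

sub : Fm → List Fm
sub (atom p) = atom p ∷ []
sub ⊥'       = ⊥' ∷ []
sub (A ∧ B)  = (A ∧ B) ∷ sub A ++ sub B
sub (A ∨ B)  = (A ∨ B) ∷ sub A ++ sub B
sub (A ⇒ B)  = (A ⇒ B) ∷ sub A ++ sub B
sub (□ A)    = □ A ∷ sub A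
sub (◇ A)    = ◇ A ∷ sub A

∈-sub : ∀ X → X ∈ sub X
∈-sub (atom p) = here refl
∈-sub ⊥'       = here refl
∈-sub (A ∧ B)  = here refl
∈-sub (A ∨ B)  = here refl
∈-sub (A ⇒ B)  = here refl
∈-sub (□ A)    = here refl
∈-sub (◇ A)    = here refl

SubTransitive : Fm → Set
SubTransitive X = ∀ {B C} → B ∈ sub X → C ∈ sub B → C ∈ sub X

sub-trans-++ : ∀ {X Y} → SubTransitive X → SubTransitive Y →
               ∀ {B C} → B ∈ sub X ++ sub Y → C ∈ sub B → C ∈ sub X ++ sub Y
sub-trans-++ {X} tX tY p q with ∈-++⁻ (sub X) p
... | inj₁ pX = ∈-++⁺ˡ (tX pX q)
... | inj₂ pY = ∈-++⁺ʳ (sub X) (tY pY q)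

sub-trans : ∀ X → SubTransitive X
sub-trans (atom p) (here refl) q = q
sub-trans ⊥'       (here refl) q = q
sub-trans (X ∧ Y)  (here refl) q = q
sub-trans (X ∧ Y)  (there p)   q = there (sub-trans-++ (sub-trans X) (sub-trans Y) p q)
sub-trans (X ∨ Y)  (here refl) q = q
sub-trans (X ∨ Y)  (there p)   q = there (sub-trans-++ (sub-trans X) (sub-trans Y) p q)
sub-trans (X ⇒ Y)  (here refl) q = q
sub-trans (X ⇒ Y)  (there p)   q = there (sub-trans-++ (sub-trans X) (sub-trans Y) p q)
sub-trans (□ X)    (here refl) q = q
sub-trans (□ X)    (there p)   q = there (sub-trans X p q)
sub-trans (◇ X)    (here refl) q = q
sub-trans (◇ X)    (there p)   q = there (sub-trans X p q)

record SubformulaClosed (S : List Fm) : Set where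
  field
    ∧-closed : ∀ {A B} → (A ∧ B) ∈ S → A ∈ S × B ∈ S
    ∨-closed : ∀ {A B} → (A ∨ B) ∈ S → A ∈ S × B ∈ S
    ⇒-closed : ∀ {A B} → (A ⇒ B) ∈ S → A ∈ S × B ∈ S
    □-closed : ∀ {A} → □ A ∈ S → A ∈ S
    ◇-closed : ∀ {A} → ◇ A ∈ S → A ∈ S

sub-closed : ∀ X → SubformulaClosed (sub X)
sub-closed X = record
  { ∧-closed = λ p → sub-trans X p (left _) , sub-trans X p (right _)
  ; ∨-closed = λ p → sub-trans X p (left _) , sub-trans X p (right _)
  ; ⇒-closed = λ p → sub-trans X p (left _) , sub-trans X p (right _)
  ; □-closed = λ p → sub-trans X p inner
  ; ◇-closed = λ p → sub-trans X p inner
  }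
  where
  left : ∀ {C A} Bs → A ∈ C ∷ sub A ++ Bs
  left {A = A} _ = there (∈-++⁺ˡ (∈-sub A))
  right : ∀ {C B} As → B ∈ C ∷ As ++ sub B
  right {B = B} As = there (∈-++⁺ʳ As (∈-sub B))
  inner : ∀ {C A} → A ∈ C ∷ sub A
  inner {A = A} = there (∈-sub A)

module Continuation (R : Set) where

  Cont : Set → Set
  Cont A = (A → R) → R

  DecR : Set → Set
  DecR Q = Q ⊎ (Q → R)

  excluded-middle : ∀ {Q} → Cont (DecR Q)
  excluded-middle k = k (inj₂ (λ q → k (inj₁ q)))

  cont-∀-Vec : ∀ n (P : Vec Bool n → Set) → (∀ v → Cont (P v)) → Cont (∀ v → P v)
  cont-∀-Vec zero    P h k = h [] (λ p → k (λ { [] → p }))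
  cont-∀-Vec (suc n) P h k =
    cont-∀-Vec n (λ v → P (true ∷ v))  (λ v → h (true ∷ v))  λ P-true →
    cont-∀-Vec n (λ v → P (false ∷ v)) (λ v → h (false ∷ v)) λ P-false →
    k (λ { (true ∷ v) → P-true v ; (false ∷ v) → P-false v })

  cont-∀-∈ : ∀ {A : Set} (xs : List A) (P : A → Set) → (∀ x → Cont (P x)) → Cont (∀ x → x ∈ xs → P x)
  cont-∀-∈ []       P h k = k (λ _ ())
  cont-∀-∈ (x ∷ xs) P h k =
    h x λ Px → cont-∀-∈ xs P h λ Pxs → k (λ { _ (here refl) → Px ; y (there q) → Pxs y q })

ModelFor-intro : ∀ L M → (T (hasN□ L) → CondN M) → (T (hasP◇ L) → CondP M) → (T (hasCK L) → CondC M) →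
                 (T (hasD L) → CondD M) → (T (hasT L) → CondT M) → ModelFor L M
ModelFor-intro MM   M n p c d t = lift tt
ModelFor-intro MMP  M n p c d t = p tt
ModelFor-intro MMN  M n p c d t = n tt
ModelFor-intro MMNP M n p c d t = n tt , p tt
ModelFor-intro MMC  M n p c d t = c tt
ModelFor-intro MK   M n p c d t = c tt , n tt
ModelFor-intro MMD  M n p c d t = d tt
ModelFor-intro MMT  M n p c d t = t tt
ModelFor-intro MMND M n p c d t = n tt , d tt
ModelFor-intro MMNT M n p c d t = n tt , t tt
ModelFor-intro MMCD M n p c d t = c tt , d tt
ModelFor-intro MMCT M n p c d t = c tt , t tt
ModelFor-intro MKD  M n p c d t = c tt , n tt , d tt
ModelFor-intro MKT  M n p c d t = c tt , n tt , t tt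

D⇒P◇⊎N□ : ∀ L → T (hasD L) → T (hasP◇ L) ⊎ T (hasN□ L)
D⇒P◇⊎N□ MMD  _ = inj₁ tt
D⇒P◇⊎N□ MMND _ = inj₂ tt
D⇒P◇⊎N□ MMCD _ = inj₁ tt
D⇒P◇⊎N□ MKD  _ = inj₂ tt

P◇-CK⇒D : ∀ L → T (hasP◇ L) → T (hasCK L) → T (hasD L)
P◇-CK⇒D MMCD _ _ = tt

module Canonical (L : Logic) (R : Set) (S : List Fm) where
  open Hypotheses L
  open Continuation R

  hyps : Subset S → List Fm
  hyps = selected S

  DecisionTable : Set
  DecisionTable = ∀ (X : Subset S) C → C ∈ S → DecR (hyps X ⊢ₕ C)

  decisionTable : Cont DecisionTable
  decisionTable = cont-∀-Vec (length S) _ λ X → cont-∀-∈ S _ λ C → excluded-middle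

  infix 4 _∋_

  _∋_ : Subset S → Fm → Set
  X ∋ D = hyps X ⊢ₕ D ⊎ R

  ∋-map : ∀ {X Y A B} → (hyps X ⊢ₕ A → hyps Y ⊢ₕ B) → X ∋ A → Y ∋ B
  ∋-map f = ⊎-map f id

  ∋-map₂ : ∀ {X A B C} → (hyps X ⊢ₕ A → hyps X ⊢ₕ B → hyps X ⊢ₕ C) → X ∋ A → X ∋ B → X ∋ C
  ∋-map₂ f (inj₁ a) (inj₁ b) = inj₁ (f a b)
  ∋-map₂ f (inj₂ r) _        = inj₂ r
  ∋-map₂ f (inj₁ _) (inj₂ r) = inj₂ r

  sequenceᴿ : ∀ {Q : Fm → Set} {Ds} → All (λ D → Q D ⊎ R) Ds → All Q Ds ⊎ R
  sequenceᴿ []             = inj₁ []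
  sequenceᴿ (inj₂ r ∷ _)   = inj₂ r
  sequenceᴿ (inj₁ d ∷ hs)  = ⊎-map (d ∷_) id (sequenceᴿ hs)

  ⊆⇒∋-all : ∀ {X Ds} (ps : All (_∈ S) Ds) → hyps (fromAll ps) ⊆ hyps X → All (X ∋_) Ds
  ⊆⇒∋-all ps ⊆X = tabulate (λ q → inj₁ (hyp (⊆X (∈-fromAll ps q))))

  -- A tag (E , _ , ¬◇E) marks a copy of a world at which ◇E must fail.
  Tag : Subset S → Set
  Tag X = Maybe (Σ Fm λ E → E ∈ S × (X ∋ ◇ E → R))

  record World : Set where
    constructor world
    field
      bits  : Subset S
      prime : ∀ {A B} → A ∈ S → B ∈ S → bits ∋ A ∨ B → bits ∋ A ⊎ bits ∋ B
      tag   : Tag bits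
  open World

  retag : (w : World) → Tag (bits w) → World
  retag w t = world (bits w) (prime w) t

  top : World
  top = world (full S) (λ pA _ _ → inj₁ (inj₁ (hyp (∈-full pA)))) nothing

  top-∋-all : ∀ {Ds} → All (_∈ S) Ds → All (bits top ∋_) Ds
  top-∋-all = All.map (λ p → inj₁ (hyp (∈-full p)))

  infix 4 _≼_

  _≼_ : World → World → Set
  w ≼ v = ∀ D → bits w ∋ D → bits v ∋ D

  ≼-retag : ∀ w t → w ≼ retag w t
  ≼-retag _ _ _ h = h

  Boxed : Subset S → List Fm → Set
  Boxed X = All (λ D → D ∈ S × X ∋ □ D)

  boxed-∈ : ∀ {X Ds} → Boxed X Ds → All (_∈ S) Ds
  boxed-∈ = All.map proj₁

  □-⋀-∋ : ∀ {X d es} → Boxed X (d ∷ es) → Conjoinable (d ∷ es) → X ∋ □ (⋀ d es)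
  □-⋀-∋ b c = ⊎-map (λ bs → □-⋀ bs c) id (sequenceᴿ (All.map proj₂ b))

  -- Intersections of □-neighbourhoods (more than one conjunct, or conjuncts together with
  -- the exclusion of the tag) need C, and the exclusion needs a tag.
  Admissible : List Fm → Bool → Set → Set
  Admissible []       false tagged = ⊥
  Admissible []       true  tagged = tagged
  Admissible (d ∷ es) false tagged = Conjoinable (d ∷ es)
  Admissible (d ∷ es) true  tagged = tagged × T (hasCK L)

  admissible-true : ∀ {j} Ds c → Admissible Ds c j → T c → Admissible Ds true j
  admissible-true _ true o _ = o

  admissible-conjoinable : ∀ {j} Ds c → Admissible Ds c j → Conjoinable Ds
  admissible-conjoinable []       _     _       = tt
  admissible-conjoinable (_ ∷ _)  false o       = o
  admissible-conjoinable (_ ∷ _)  true  (_ , ck) = inj₂ ck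

  admissible-++ : T (hasCK L) → ∀ {j} Ds₁ c₁ Ds₂ c₂ →
                  Admissible Ds₁ c₁ j → Admissible Ds₂ c₂ j → Admissible (Ds₁ ++ Ds₂) (c₁ or c₂) j
  admissible-++ ck []      true  []      _     o₁       _        = o₁
  admissible-++ ck []      true  (_ ∷ _) _     o₁       _        = o₁ , ck
  admissible-++ ck (_ ∷ _) false []      true  _        o₂       = o₂ , ck
  admissible-++ ck (_ ∷ _) false (_ ∷ _) false _        _        = inj₂ ck
  admissible-++ ck (_ ∷ _) false (_ ∷ _) true  _        (j , _)  = j , ck
  admissible-++ ck (_ ∷ _) true  _       _     (j , _)  _        = j , ck

  conjoinable-++ : ∀ {j} Ds₁ c₁ Ds₂ c₂ → Admissible Ds₁ c₁ j → Admissible Ds₂ c₂ j →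
                   T (c₁ or c₂) → Conjoinable (Ds₁ ++ Ds₂)
  conjoinable-++ []       c₁    Ds₂      c₂    _       o₂       _ = admissible-conjoinable Ds₂ c₂ o₂
  conjoinable-++ (_ ∷ _)  true  _        _     (_ , ck) _       _ = inj₂ ck
  conjoinable-++ Ds₁      false []       c₂    o₁       _        _
    rewrite ++-identityʳ Ds₁ = admissible-conjoinable Ds₁ false o₁
  conjoinable-++ (_ ∷ _)  false (_ ∷ _)  true  _        (_ , ck) _ = inj₂ ck

  ◇-of-boxes : T (hasD L) → ∀ {X d es E} → Boxed X (d ∷ es) → Conjoinable (d ∷ es) →
               d ∷ es ⊢ₕ E → X ∋ ◇ E
  ◇-of-boxes hd b c ⊢E = ∋-map (λ □⋀ → app (thm (axD hd)) (app (thm (mon□ (⋀-⇒ ⊢E))) □⋀)) (□-⋀-∋ b c)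

  ◇-of-theorem : T (hasP◇ L) ⊎ (T (hasD L) × T (hasN□ L)) → ∀ {X E} → [] ⊢ₕ E → X ∋ ◇ E
  ◇-of-theorem (inj₁ hp)        ⊢E = inj₁ (thm (mp (mon◇ (mp axK (closed ⊢E))) (axP◇ hp)))
  ◇-of-theorem (inj₂ (hd , hn)) ⊢E = inj₁ (thm (mp (axD hd) (mp (mon□ (mp axK (closed ⊢E))) (axN□ hn))))

  ◇-of-consequence : T (hasD L) → T (hasP◇ L) ⊎ T (hasN□ L) → ∀ {X E} Ds → Boxed X Ds →
                     Conjoinable Ds → Ds ⊢ₕ E → X ∋ ◇ E
  ◇-of-consequence hd hpn []       _ _ = ◇-of-theorem (⊎-map id (hd ,_) hpn)
  ◇-of-consequence hd hpn (_ ∷ _)  b c = ◇-of-boxes hd b c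

  ◇-transfer : ∀ {X j B E} Ds → Admissible Ds true j → Boxed X Ds → X ∋ ◇ B → B ∷ Ds ⊢ₕ E → X ∋ ◇ E
  ◇-transfer []       _        _ ◇B ⊢E = ∋-map (app (thm (mon◇ (⋀-⇒ ⊢E)))) ◇B
  ◇-transfer (_ ∷ _)  (_ , ck) b ◇B ⊢E =
    ∋-map₂ (λ □⋀ → app (app (thm (axK◇ ck)) (app (thm (mon□ (⋀-⇒-⇒ ⊢E))) □⋀))) (□-⋀-∋ b (inj₂ ck)) ◇B

  Excludes : ∀ {X} → Bool → Tag X → World → Set
  Excludes false _                  _ = ⊤
  Excludes true  nothing            _ = ⊤
  Excludes true  (just (E , _ , _)) u = bits u ∋ E → R

  excludes-weaken : ∀ {X} c (t : Tag X) {u} → Excludes true t u → Excludes c t u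
  excludes-weaken false _ _ = tt
  excludes-weaken true  _ e = e

  excludes-or⁺ : ∀ {X} c₁ c₂ (t : Tag X) {u} → Excludes c₁ t u → Excludes c₂ t u → Excludes (c₁ or c₂) t u
  excludes-or⁺ false _ _ _  e₂ = e₂
  excludes-or⁺ true  _ _ e₁ _  = e₁

  excludes-or⁻ : ∀ {X} c₁ c₂ (t : Tag X) {u} → Excludes (c₁ or c₂) t u → Excludes c₁ t u × Excludes c₂ t u
  excludes-or⁻ false _  _ e = tt , e
  excludes-or⁻ true  c₂ t e = e , excludes-weaken c₂ t e

  InNbhd : World → List Fm → Bool → World → Set
  InNbhd w Ds c u = All (bits u ∋_) Ds × Excludes c (tag w) u

  InNbhd-∩⁺ : ∀ w Ds₁ c₁ Ds₂ c₂ {u} → InNbhd w Ds₁ c₁ u → InNbhd w Ds₂ c₂ u →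
              InNbhd w (Ds₁ ++ Ds₂) (c₁ or c₂) u
  InNbhd-∩⁺ w _ c₁ _ c₂ (h₁ , e₁) (h₂ , e₂) = ++⁺ h₁ h₂ , excludes-or⁺ c₁ c₂ (tag w) e₁ e₂

  InNbhd-∩⁻ : ∀ w Ds₁ c₁ Ds₂ c₂ {u} → InNbhd w (Ds₁ ++ Ds₂) (c₁ or c₂) u →
              InNbhd w Ds₁ c₁ u × InNbhd w Ds₂ c₂ u
  InNbhd-∩⁻ w Ds₁ c₁ _ c₂ (h , e) =
    let e₁ , e₂ = excludes-or⁻ c₁ c₂ (tag w) e in (++⁻ˡ Ds₁ h , e₁) , (++⁻ʳ Ds₁ h , e₂)

  infix 4 _≐_

  _≐_ : (World → Set) → (World → Set) → Set
  α ≐ β = ∀ u → (α u → β u) × (β u → α u)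

  ≐-refl : ∀ {α} → α ≐ α
  ≐-refl _ = id , id

  record Neighbourhood (w : World) (α : World → Set) : Set where
    constructor nbhd
    field
      conjuncts  : List Fm
      excluding  : Bool
      admissible : Admissible conjuncts excluding (Is-just (tag w))
      boxed      : Boxed (bits w) conjuncts
      extent     : α ≐ InNbhd w conjuncts excluding

  Excludable : ∀ {X} → Bool → Tag X → List Fm → Set
  Excludable false _                  Γ = ⊤
  Excludable true  nothing            Γ = ⊤
  Excludable true  (just (E , _ , _)) Γ = Γ ⊢ₕ E → R

  excludable-from-◇ : ∀ {X Γ} c (t : Tag X) → (T c → ∀ {E} → Γ ⊢ₕ E → X ∋ ◇ E) → Excludable c t Γ
  excludable-from-◇ false _                    _  = tt
  excludable-from-◇ true  nothing              _  = tt
  excludable-from-◇ true  (just (_ , _ , ¬◇E)) ◇Γ = λ ⊢E → ¬◇E (◇Γ tt ⊢E)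

  module _ (closure : SubformulaClosed S) (⊤∈S : ⊤' ∈ S) (decide : DecisionTable) where
    open SubformulaClosed closure

    extend : ∀ {C ys} → C ∈ S → All (_∈ S) ys → Subset S → Subset S
    extend pC []       Z = Z
    extend pC (p ∷ ps) Z with decide (insert p Z) _ pC
    ... | inj₁ _ = extend pC ps Z
    ... | inj₂ _ = extend pC ps (insert p Z)

    record Extension (C : Fm) (ys : List Fm) (Z Y : Subset S) : Set where
      field
        extends : hyps Z ⊆ hyps Y
        avoids  : (hyps Z ⊢ₕ C → R) → hyps Y ⊢ₕ C → R
        maximal : ∀ {D} → D ∈ ys → D ∈ hyps Y ⊎ D ∷ hyps Y ⊢ₕ C

    extension : ∀ {C ys} (pC : C ∈ S) (ps : All (_∈ S) ys) Z → Extension C ys Z (extend pC ps Z)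
    extension pC [] Z = record { extends = id ; avoids = id ; maximal = λ () }
    extension pC (p ∷ ps) Z with decide (insert p Z) _ pC
    ... | inj₁ y⊢C = record
      { extends = extends
      ; avoids  = avoids
      ; maximal = λ { (here refl) → inj₂ (weaken (λ q → ∷⁺ʳ _ extends (insert-⊆ p Z q)) y⊢C)
                    ; (there q)   → maximal q }
      }
      where open Extension (extension pC ps Z)
    ... | inj₂ y⊬C = record
      { extends = λ q → extends (⊆-insert p Z q)
      ; avoids  = λ _ → avoids y⊬C
      ; maximal = λ { (here refl) → inj₁ (extends (∈-insert p Z)) ; (there q) → maximal q }
      }
      where open Extension (extension pC ps (insert p Z))

    module Lindenbaum {C} (pC : C ∈ S) (Z : Subset S) (Z⊬C : hyps Z ⊢ₕ C → R) where
      private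
        Y : Subset S
        Y = extend pC (tabulate id) Z

        ext : Extension C S Z Y
        ext = extension pC (tabulate id) Z

        open Extension ext using (maximal) renaming (avoids to avoids-given)

        Y-prime : ∀ {A B} → A ∈ S → B ∈ S → Y ∋ A ∨ B → Y ∋ A ⊎ Y ∋ B
        Y-prime _  _  (inj₂ r) = inj₁ (inj₂ r)
        Y-prime pA pB (inj₁ ⊢A∨B) with maximal pA | maximal pB
        ... | inj₁ A∈Y | _        = inj₁ (inj₁ (hyp A∈Y))
        ... | inj₂ _   | inj₁ B∈Y = inj₂ (inj₁ (hyp B∈Y))
        ... | inj₂ A⊢C | inj₂ B⊢C = inj₁ (inj₂ (avoids-given Z⊬C (∨-elim ⊢A∨B A⊢C B⊢C)))

      extension-world : World
      extension-world = world Y Y-prime nothing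

      open Extension ext public using (extends)

      avoids : bits extension-world ∋ C → R
      avoids = [ avoids-given Z⊬C , id ]

    -- Only a world that has to refute the tag of w can fail to be the inconsistent top world.
    realise : ∀ w {Γ} → All (_∈ S) Γ → ∀ c → Excludable c (tag w) Γ → Σ World (InNbhd w Γ c)
    realise w ps false _ = top , top-∋-all ps , tt
    realise w ps true Γ⊬E with tag w
    ... | nothing = top , top-∋-all ps , tt
    ... | just (E , pE , _) with decide (fromAll ps) E pE
    ...   | inj₁ ⊢E = top , top-∋-all ps , λ _ → Γ⊬E (weaken (fromAll-⊆ ps) ⊢E)
    ...   | inj₂ ⊬E = extension-world , ⊆⇒∋-all ps extends , avoids
      where open Lindenbaum pE (fromAll ps) ⊬E

    canonical : Model
    canonical = record
      { W = World ; inhab = top ; _≤_ = _≼_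
      ; ≤-refl = λ _ h → h ; ≤-trans = λ p q D h → q D (p D h)
      ; F = λ w → bits w ∋ ⊥' ; F-up = λ le → le _
      ; V = λ p w → bits w ∋ atom p ; V-up = λ _ le → le _
      ; N = Neighbourhood
      }

    ◇-witness : ∀ {B α} → B ∈ S → ∀ w → bits w ∋ ◇ B → Neighbourhood w α →
                Σ World λ u → α u × bits u ∋ B
    ◇-witness pB w ◇B (nbhd Ds c o b e) =
      let u , holds , excl = realise w (pB ∷ boxed-∈ b) c (excludable-from-◇ c (tag w) λ c-true →
                               ◇-transfer Ds (admissible-true Ds c o c-true) b ◇B)
      in u , proj₂ (e u) (All.tail holds , excl) , All.head holds

    holds⇒forces : ∀ D → D ∈ S → ∀ w → bits w ∋ D → forces canonical w D
    forces⇒holds : ∀ D → D ∈ S → ∀ w → forces canonical w D → bits w ∋ D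

    holds⇒forces (atom p) _ w h = lift h
    holds⇒forces ⊥'       _ w h = lift h
    holds⇒forces (A ∧ B) pD w h =
      holds⇒forces A (proj₁ (∧-closed pD)) w (∋-map ∧-elim₁ h) ,
      holds⇒forces B (proj₂ (∧-closed pD)) w (∋-map ∧-elim₂ h)
    holds⇒forces (A ∨ B) pD w h =
      let pA , pB = ∨-closed pD in ⊎-map (holds⇒forces A pA w) (holds⇒forces B pB w) (prime w pA pB h)
    holds⇒forces (A ⇒ B) pD w h v w≼v ⊩A =
      let pA , pB = ⇒-closed pD in holds⇒forces B pB v (∋-map₂ app (w≼v _ h) (forces⇒holds A pA v ⊩A))
    holds⇒forces (□ B) pD w h v w≼v =
      InNbhd v (B ∷ []) false ,
      nbhd (B ∷ []) false (inj₁ refl) ((□-closed pD , w≼v _ h) ∷ []) ≐-refl ,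
      λ u u∈ → holds⇒forces B (□-closed pD) u (All.head (proj₁ u∈))
    holds⇒forces (◇ B) pD w h v w≼v α α∈N =
      let u , u∈α , B-holds = ◇-witness (◇-closed pD) v (w≼v _ h) α∈N
      in u , u∈α , holds⇒forces B (◇-closed pD) u B-holds

    forces⇒holds (atom p) _ w ⊩p = lower ⊩p
    forces⇒holds ⊥'       _ w ⊩⊥ = lower ⊩⊥
    forces⇒holds (A ∧ B) pD w (⊩A , ⊩B) =
      ∋-map₂ ∧-intro (forces⇒holds A (proj₁ (∧-closed pD)) w ⊩A) (forces⇒holds B (proj₂ (∧-closed pD)) w ⊩B)
    forces⇒holds (A ∨ B) pD w (inj₁ ⊩A) = ∋-map ∨-intro₁ (forces⇒holds A (proj₁ (∨-closed pD)) w ⊩A)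
    forces⇒holds (A ∨ B) pD w (inj₂ ⊩B) = ∋-map ∨-intro₂ (forces⇒holds B (proj₂ (∨-closed pD)) w ⊩B)
    forces⇒holds (A ⇒ B) pD w ⊩A⇒B
      with decide (insert (proj₁ (⇒-closed pD)) (bits w)) B (proj₂ (⇒-closed pD))
    ... | inj₁ ⊢B = inj₁ (deduction (weaken (insert-⊆ (proj₁ (⇒-closed pD)) (bits w)) ⊢B))
    ... | inj₂ ⊬B = inj₂ (avoids (forces⇒holds B pB extension-world (⊩A⇒B extension-world w≼u ⊩A)))
      where
      pA : A ∈ S
      pA = proj₁ (⇒-closed pD)
      pB : B ∈ S
      pB = proj₂ (⇒-closed pD)
      open Lindenbaum pB (insert pA (bits w)) ⊬B
      w≼u : w ≼ extension-world
      w≼u _ = ∋-map (weaken (λ q → extends (⊆-insert pA (bits w) q)))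
      ⊩A : forces canonical extension-world A
      ⊩A = holds⇒forces A pA extension-world (inj₁ (hyp (extends (∈-insert pA (bits w)))))
    -- The untagged copy of w has only □-neighbourhoods.
    forces⇒holds (□ B) pD w ⊩□B with ⊩□B (retag w nothing) (≼-retag w nothing)
    ... | _ , nbhd []      false ()      _ _ , _
    ... | _ , nbhd []      true  ()      _ _ , _
    ... | _ , nbhd (_ ∷ _) true  (() , _) _ _ , _
    ... | _ , nbhd (d ∷ es) false c b e , α⊩B with decide (fromAll (boxed-∈ b)) B (□-closed pD)
    ...   | inj₁ ⊢B = ∋-map (app (thm (mon□ (⋀-⇒ (weaken (fromAll-⊆ (boxed-∈ b)) ⊢B))))) (□-⋀-∋ b c)
    ...   | inj₂ ⊬B = inj₂ (avoids (forces⇒holds B (□-closed pD) extension-world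
                                     (α⊩B extension-world (proj₂ (e _) (⊆⇒∋-all (boxed-∈ b) extends , tt)))))
      where open Lindenbaum (□-closed pD) (fromAll (boxed-∈ b)) ⊬B
    forces⇒holds (◇ B) pD w ⊩◇B with decide (bits w) (◇ B) pD
    ... | inj₁ ⊢◇B = inj₁ ⊢◇B
    ... | inj₂ ⊬◇B =
      let u , (_ , u-refutes-B) , u⊩B = ⊩◇B w′ (≼-retag w t) (InNbhd w′ [] true) (nbhd [] true (just tt) [] ≐-refl)
      in inj₂ (u-refutes-B (forces⇒holds B (◇-closed pD) u u⊩B))
      where
      t : Tag (bits w)
      t = just (B , ◇-closed pD , [ ⊬◇B , id ])
      w′ : World
      w′ = retag w t

    condN : T (hasN□ L) → CondN canonical
    condN hn w = InNbhd w (⊤' ∷ []) false ,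
                 nbhd (⊤' ∷ []) false (inj₁ refl) ((⊤∈S , inj₁ (thm (axN□ hn))) ∷ []) ≐-refl

    condT : T (hasT L) → CondT canonical
    condT ht w α (nbhd Ds c _ b e) =
      proj₂ (e w) (All.map (λ (_ , □D) → ∋-map (app (thm (axT□ ht))) □D) b , excludes-self c (tag w))
      where
      excludes-self : ∀ c (t : Tag (bits w)) → Excludes c t w
      excludes-self false _                      = tt
      excludes-self true  nothing                = tt
      excludes-self true  (just (_ , _ , ¬◇E)) = λ E → ¬◇E (∋-map (app (thm (axT◇ ht))) E)

    condC : T (hasCK L) → CondC canonical
    condC ck w α β (nbhd Ds₁ c₁ o₁ b₁ e₁) (nbhd Ds₂ c₂ o₂ b₂ e₂) =
      nbhd (Ds₁ ++ Ds₂) (c₁ or c₂) (admissible-++ ck Ds₁ c₁ Ds₂ c₂ o₁ o₂) (++⁺ b₁ b₂) λ u →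
        (λ (a , b) → InNbhd-∩⁺ w Ds₁ c₁ Ds₂ c₂ (proj₁ (e₁ u) a) (proj₁ (e₂ u) b)) ,
        (λ u∈ → let u∈₁ , u∈₂ = InNbhd-∩⁻ w Ds₁ c₁ Ds₂ c₂ u∈ in proj₂ (e₁ u) u∈₁ , proj₂ (e₂ u) u∈₂)

    condP : T (hasP◇ L) → CondP canonical
    condP hp w α (nbhd Ds c o b e) =
      let u , u∈ = realise w (boxed-∈ b) c (excludable-from-◇ c (tag w) λ c-true →
                     ◇-consequences Ds (admissible-true Ds c o c-true) b)
      in u , proj₂ (e u) u∈
      where
      ◇-consequences : ∀ Ds → Admissible Ds true (Is-just (tag w)) → Boxed (bits w) Ds →
                       ∀ {E} → Ds ⊢ₕ E → bits w ∋ ◇ E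
      ◇-consequences []       _        _ = ◇-of-theorem (inj₁ hp)
      ◇-consequences (_ ∷ _)  (_ , ck) b = ◇-of-boxes (P◇-CK⇒D L hp ck) b (inj₂ ck)

    condD : T (hasD L) → T (hasP◇ L) ⊎ T (hasN□ L) → CondD canonical
    condD hd hpn w α β (nbhd Ds₁ c₁ o₁ b₁ e₁) (nbhd Ds₂ c₂ o₂ b₂ e₂) =
      let u , u∈ = realise w (boxed-∈ b₁₂) (c₁ or c₂) (excludable-from-◇ (c₁ or c₂) (tag w) λ c-true →
                     ◇-of-consequence hd hpn (Ds₁ ++ Ds₂) b₁₂ (conjoinable-++ Ds₁ c₁ Ds₂ c₂ o₁ o₂ c-true))
          u∈₁ , u∈₂ = InNbhd-∩⁻ w Ds₁ c₁ Ds₂ c₂ u∈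
      in u , proj₂ (e₁ u) u∈₁ , proj₂ (e₂ u) u∈₂
      where
      b₁₂ : Boxed (bits w) (Ds₁ ++ Ds₂)
      b₁₂ = ++⁺ b₁ b₂

    canonical-for : ModelFor L canonical
    canonical-for = ModelFor-intro L canonical condN condP condC (λ hd → condD hd (D⇒P◇⊎N□ L hd)) condT

    complete : ∀ {A} → A ∈ S → ([] ⊢ₕ A → R) → Valid L A → R
    complete {A} pA ⊬A valid =
      avoids (forces⇒holds A pA extension-world (valid canonical canonical-for extension-world))
      where open Lindenbaum pA (empty S) (λ ⊢A → ⊬A (weaken (λ q → ⊥-elim (∉-empty S q)) ⊢A))

mainTheorem14 : ∀ (L : Logic) (A : Fm) → Valid L A → L ⊢ A
mainTheorem14 L A valid = decisionTable refute
  where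
  open Hypotheses L
  open Canonical L (L ⊢ A) (sub (A ∧ □ ⊤'))
  -- The conjunct □⊤ only puts ⊤ into S, for the neighbourhood witnessing N□.
  refute : DecisionTable → L ⊢ A
  refute decide = complete (sub-closed (A ∧ □ ⊤')) ⊤∈S decide A∈S closed valid
    where
    A∈S : A ∈ sub (A ∧ □ ⊤')
    A∈S = there (∈-++⁺ˡ (∈-sub A))
    ⊤∈S : ⊤' ∈ sub (A ∧ □ ⊤')
    ⊤∈S = there (∈-++⁺ʳ (sub A) (there (here refl)))
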